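{- Let $Q$ be a tile with $r$ vertices $q_1,\dots,q_r$ (in clockwise order) of a tiling $T$ of the $n$-gon $P$. Then every long strand $x\leadsto y$ for $Q$ covers exactly $r-2$ vertices of $Q$, and for every such strand there are exactly two vertices $q_{i-1},q_i$ of $Q$ (consecutive in the clockwise order of $Q$) that are not covered, and these satisfy: $y,q_{i-1},q_i,x$ occur in this clockwise cyclic order, where $y=q_{i-1}$ and/or $q_i=x$ are allowed.
   Context: Let $P$ be a convex polygon with vertices labelled $1,\dots,n$ ($n\ge3$) in clockwise order, labels modulo $n$. A tiling $T$ is a (possibly empty) set of pairwise non-crossing (in their interiors) diagonals; tiles are the closures of the components of $P$ minus the diagonals. Scott strand construction: for each tile $Q$ with vertices $q_1,\dots,q_r$ in clockwise order (indices mod $r$) and each $j$, draw inside $Q$ a strand segment parallel to $[q_{j-1},q_j]$, entering $Q$ through the side $[q_j,q_{j+1}]$ near $q_j$ and leaving $Q$ through the side $[q_{j-2},q_{j-1}]$ near $q_{j-1}$; if the entering side is a boundary edge of $P$ the segment starts at vertex $q_j$, and if the leaving side is a boundary edge it ends at vertex $q_{j-1}$. At a diagonal shared by two tiles, a segment leaving one tile near an endpoint $v$ is continued by the segment of the other tile entering near $v$. Concatenation gives strands $x\leadsto y$ from vertex $x$ to vertex $y$. A strand is a long strand for a tile $Q$ if it uses one of the strand segments of $Q$. A strand $x\leadsto y$ covers a vertex $q$ if $q$ lies strictly between $x$ and $y$ going clockwise from $x$ to $y$ (i.e. $x,q,y$ are distinct and in clockwise cyclic order). -}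

module Defs where

-- Combinatorial model of tilings of a convex n-gon and Scott strands.
-- Vertices are Fin n (label i ∈ {0,…,n-1} stands for the paper's i+1);
-- clockwise order = increasing labels, cyclically.

open import Data.Nat using (ℕ; zero; suc; _+_; _∸_; _<_; _≤_; _≤ᵇ_; _<?_)
open import Data.Nat.DivMod using (_mod_)
open import Data.Fin using (Fin; toℕ)
open import Data.Bool using (if_then_else_)
open import Data.Product using (Σ; _×_; _,_; proj₁; proj₂)
open import Data.Sum using (_⊎_; inj₁; inj₂)
open import Data.List using (List)
open import Data.List.Membership.Propositional using (_∈_)
open import Data.Vec using (count; allFin)
open import Relation.Binary.PropositionalEquality using (_≡_; _≢_)
open import Relation.Nullary using (¬_; Dec)
open import Relation.Nullary.Decidable using (_×-dec_; _⊎-dec_)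

module _ {n : ℕ} where

  Cyc : Fin n → Fin n → Fin n → Set
  Cyc a b c = (toℕ a < toℕ b × toℕ b < toℕ c)
            ⊎ (toℕ b < toℕ c × toℕ c < toℕ a)
            ⊎ (toℕ c < toℕ a × toℕ a < toℕ b)

  cyc? : (a b c : Fin n) → Dec (Cyc a b c)
  cyc? a b c = ((toℕ a <? toℕ b) ×-dec (toℕ b <? toℕ c))
          ⊎-dec (((toℕ b <? toℕ c) ×-dec (toℕ c <? toℕ a))
          ⊎-dec ((toℕ c <? toℕ a) ×-dec (toℕ a <? toℕ b)))

  cd : Fin n → Fin n → ℕ
  cd a b = if toℕ a ≤ᵇ toℕ b then toℕ b ∸ toℕ a else (n + toℕ b) ∸ toℕ a

  CwEdge : Fin n → Fin n → Set
  CwEdge a b = (suc (toℕ a) ≡ toℕ b) ⊎ (suc (toℕ a) ≡ n × toℕ b ≡ 0)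

  BoundaryEdge : Fin n → Fin n → Set
  BoundaryEdge a b = CwEdge a b ⊎ CwEdge b a

  IsDiagonal : Fin n → Fin n → Set
  IsDiagonal a b = a ≢ b × ¬ BoundaryEdge a b

  Diagonals : Set
  Diagonals = List (Fin n × Fin n)

  InT : Diagonals → Fin n → Fin n → Set
  InT T a b = (a , b) ∈ T ⊎ (b , a) ∈ T

  Crosses : Fin n → Fin n → Fin n → Fin n → Set
  Crosses a b c d = (Cyc a c b × Cyc b d a) ⊎ (Cyc a d b × Cyc b c a)

  IsTiling : Diagonals → Set
  IsTiling T = (∀ {a b} → (a , b) ∈ T → IsDiagonal a b)
             × (∀ {a b c d} → (a , b) ∈ T → (c , d) ∈ T → ¬ Crosses a b c d)

  -- A tile of T with r = 3 + k vertices vert 0, …, vert (r-1) in clockwise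
  -- order: every side is a boundary edge or a diagonal of T, and no diagonal
  -- of T joins two non-consecutive vertices (so no diagonal enters the tile).
  record Tile (T : Diagonals) : Set where
    field
      k    : ℕ
      vert : Fin (3 + k) → Fin n
      clockwise : ∀ (i j l : Fin (3 + k)) → toℕ i < toℕ j → toℕ j < toℕ l
                  → Cyc (vert i) (vert j) (vert l)
      sides : ∀ (i : Fin (3 + k))
              → BoundaryEdge (vert i) (vert ((toℕ i + 1) mod (3 + k)))
                ⊎ InT T (vert i) (vert ((toℕ i + 1) mod (3 + k)))
      noInterior : ∀ (i j : Fin (3 + k)) → InT T (vert i) (vert j)
                   → vert ((toℕ i + 1) mod (3 + k)) ≡ vert j
                     ⊎ vert ((toℕ j + 1) mod (3 + k)) ≡ vert i

  module _ {T : Diagonals} where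
    open Tile

    size : Tile T → ℕ
    size Q = 3 + k Q

    q : (Q : Tile T) → ℕ → Fin n
    q Q m = vert Q (m mod size Q)

    -- strand segments: segment j of tile Q enters through [q_j, q_{j+1}]
    -- near q_j and leaves through [q_{j-2}, q_{j-1}] near q_{j-1}
    Seg : Set
    Seg = Σ (Tile T) (λ Q → Fin (size Q))

    entryV entryV' exitV exitV' : Seg → Fin n
    entryV (Q , j) = q Q (toℕ j)
    entryV' (Q , j) = q Q (toℕ j + 1)
    exitV (Q , j) = q Q (toℕ j + (2 + k Q))       -- q_{j-1}
    exitV' (Q , j) = q Q (toℕ j + (1 + k Q))      -- q_{j-2}

    -- the entering side is a boundary edge (the strand starts at entryV)
    StartsAtBoundary : Seg → Set
    StartsAtBoundary s = BoundaryEdge (entryV s) (entryV' s)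

    -- the leaving side is a boundary edge (the strand ends at exitV)
    EndsAtBoundary : Seg → Set
    EndsAtBoundary s = BoundaryEdge (exitV' s) (exitV s)

    Next : Seg → Seg → Set
    Next s s' = InT T (exitV' s) (exitV s)
              × entryV s' ≡ exitV s × entryV' s' ≡ exitV' s

    data Reach : Seg → Seg → Set where
      here  : ∀ {s} → Reach s s
      there : ∀ {s s₁ s'} → Next s s₁ → Reach s₁ s' → Reach s s'

    LongStrandFor : Tile T → Fin n → Fin n → Set
    LongStrandFor Q x y =
      Σ (Fin (size Q)) λ j → Σ Seg λ s₀ → Σ Seg λ s₁ →
        StartsAtBoundary s₀ × entryV s₀ ≡ x × Reach s₀ (Q , j)
        × Reach (Q , j) s₁ × EndsAtBoundary s₁ × exitV s₁ ≡ y

  Covers : Fin n → Fin n → Fin n → Set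
  Covers x y v = Cyc x v y

  coveredCount : {T : Diagonals} → Tile T → Fin n → Fin n → ℕ
  coveredCount Q x y =
    count (λ i → cyc? x (Tile.vert Q i) y) (allFin (size Q))

module Submission where

-- If a segment enters its tile through the side [a , b]
-- near a, the start x of the strand lies in the clockwise arc [a , b); the next segment enters
-- near q_{j-1} through the side [q_{j-2} , q_{j-1}] by which this one leaves, and [q_j , q_{j+1})
-- lies inside [q_{j-1} , q_{j-2}), so the invariant passes on. Symmetrically, backwards, the end y
-- lies in the arc (c , d] of the leaving side [c , d]. For the segment j of Q this gives
-- x ∈ [q_j , q_{j+1}) and y ∈ (q_{j-2} , q_{j-1}], so x ⇝ y covers q_{j+1}, …, q_{j-2} and
-- misses exactly q_{j-1} and q_j. Comparisons are made through clockwise distances from q_j,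
-- which turn the cyclic order into the linear order on ℕ.

open import Defs
open import Data.Nat using (ℕ; _≤_; _<_; _∸_; _+_)
open import Data.Fin using (Fin; toℕ)
open import Data.Product using (Σ; _×_)
open import Relation.Binary.PropositionalEquality using (_≡_; _≢_)
open import Relation.Nullary using (¬_)

open import Data.Bool using (true; false; if_then_else_; T)
open import Data.Empty using (⊥-elim)
open import Data.Fin.Properties using (toℕ<n; toℕ-injective; toℕ-fromℕ<; suc-injective)
open import Data.Nat using (zero; suc; _≤ᵇ_; _≤?_; _<?_; _≟_; z≤n; s≤s; s≤s⁻¹; z<s; NonZero)
open import Data.Nat.DivMod using (_%_; _mod_; m%n<n; m<n⇒m%n≡m; [m+n]%n≡m%n; m≤n⇒[n∸m]%m≡n%m)
open import Data.Nat.Properties hiding (suc-injective)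
open import Data.Product using (_,_; proj₁; proj₂; map₂; uncurry)
open import Data.Sum using (_⊎_; inj₁; inj₂)
open import Data.Unit using (tt)
open import Data.Vec using (count; tabulate)
open import Function using (_∘_)
open import Relation.Binary using (tri<; tri≈; tri>)
open import Relation.Binary.PropositionalEquality
  using (refl; sym; trans; cong; subst; subst₂; module ≡-Reasoning)
open import Relation.Nullary using (yes; no)
open import Relation.Unary using (Pred; Decidable)
import Data.Fin as Fin

Cyclic : ℕ → ℕ → ℕ → Set
Cyclic a b c = (a < b × b < c) ⊎ (b < c × c < a) ⊎ (c < a × a < b)

cyclic-rotate : ∀ {a b c} → Cyclic a b c → Cyclic b c a
cyclic-rotate (inj₁ p)        = inj₂ (inj₂ p)
cyclic-rotate (inj₂ (inj₁ p)) = inj₁ p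
cyclic-rotate (inj₂ (inj₂ p)) = inj₂ (inj₁ p)

cyclic-irreflˡ : ∀ {a c} → ¬ Cyclic a a c
cyclic-irreflˡ (inj₁ (a<a , _))        = <-irrefl refl a<a
cyclic-irreflˡ (inj₂ (inj₁ (a<c , c<a))) = <-asym a<c c<a
cyclic-irreflˡ (inj₂ (inj₂ (_ , a<a))) = <-irrefl refl a<a

cyclic-asym : ∀ {a b c} → Cyclic a b c → ¬ Cyclic a c b
cyclic-asym (inj₁ (_ , q))        (inj₁ (_ , s))        = <-asym q s
cyclic-asym (inj₁ (p , _))        (inj₂ (inj₁ (_ , s))) = <-asym p s
cyclic-asym (inj₁ (p , _))        (inj₂ (inj₂ (r , _))) = <-asym p r
cyclic-asym (inj₂ (inj₁ (_ , q))) (inj₁ (r , _))        = <-asym q r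
cyclic-asym (inj₂ (inj₁ (p , _))) (inj₂ (inj₁ (r , _))) = <-asym p r
cyclic-asym (inj₂ (inj₁ (_ , q))) (inj₂ (inj₂ (_ , s))) = <-asym q s
cyclic-asym (inj₂ (inj₂ (p , _))) (inj₁ (r , _))        = <-asym p r
cyclic-asym (inj₂ (inj₂ (_ , q))) (inj₂ (inj₁ (_ , s))) = <-asym q s
cyclic-asym (inj₂ (inj₂ (p , _))) (inj₂ (inj₂ (_ , s))) = <-asym p s

cyclic-total : ∀ a b c → a ≢ b → b ≢ c → a ≢ c → Cyclic a b c ⊎ Cyclic a c b
cyclic-total a b c a≢b b≢c a≢c with <-cmp a b | <-cmp b c | <-cmp a c
... | tri≈ _ p _ | _          | _          = ⊥-elim (a≢b p)
... | _          | tri≈ _ p _ | _          = ⊥-elim (b≢c p)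
... | _          | _          | tri≈ _ p _ = ⊥-elim (a≢c p)
... | tri< p _ _ | tri< q _ _ | _          = inj₁ (inj₁ (p , q))
... | tri< _ _ _ | tri> _ _ q | tri< r _ _ = inj₂ (inj₁ (r , q))
... | tri< p _ _ | tri> _ _ _ | tri> _ _ r = inj₁ (inj₂ (inj₂ (r , p)))
... | tri> _ _ p | tri< _ _ _ | tri< r _ _ = inj₂ (inj₂ (inj₂ (p , r)))
... | tri> _ _ _ | tri< q _ _ | tri> _ _ r = inj₁ (inj₂ (inj₁ (q , r)))
... | tri> _ _ p | tri> _ _ q | _          = inj₂ (inj₂ (inj₁ (q , p)))

cyclic⇒between : ∀ {a b c} → a < c → Cyclic a b c → a < b × b < c
cyclic⇒between _   (inj₁ p)               = p
cyclic⇒between a<c (inj₂ (inj₁ (_ , c<a))) = ⊥-elim (<-asym a<c c<a)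
cyclic⇒between a<c (inj₂ (inj₂ (c<a , _))) = ⊥-elim (<-asym a<c c<a)

cyclic-0 : ∀ {b c} → Cyclic 0 b c → 0 < b × b < c
cyclic-0 (inj₁ p)               = p
cyclic-0 (inj₂ (inj₁ (_ , ())))
cyclic-0 (inj₂ (inj₂ (() , _)))

-- cd a b unfolds to cwDist n (toℕ a) (toℕ b), just as Cyc unfolds to Cyclic on the labels.
cwDist : ℕ → ℕ → ℕ → ℕ
cwDist n e u = if e ≤ᵇ u then u ∸ e else n + u ∸ e

cwDist-≤ : ∀ n {e u} → e ≤ u → cwDist n e u ≡ u ∸ e
cwDist-≤ n {e} {u} e≤u with e ≤ᵇ u in eq
... | true  = refl
... | false = ⊥-elim (subst T eq (≤⇒≤ᵇ e≤u))

cwDist-> : ∀ n {e u} → u < e → cwDist n e u ≡ n + u ∸ e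
cwDist-> n {e} {u} u<e with e ≤ᵇ u in eq
... | true  = ⊥-elim (<⇒≱ u<e (≤ᵇ⇒≤ e u (subst T (sym eq) tt)))
... | false = refl

cwDist-self : ∀ n e → cwDist n e e ≡ 0
cwDist-self n e = trans (cwDist-≤ n {e} ≤-refl) (n∸n≡0 e)

cwDist-< : ∀ {n e u} → e < n → u < n → cwDist n e u < n
cwDist-< {n} {e} {u} e<n u<n with e ≤? u
... | yes e≤u rewrite cwDist-≤ n e≤u = ≤-<-trans (m∸n≤m u e) u<n
... | no e≰u rewrite cwDist-> n (≰⇒> e≰u) =
  subst (n + u ∸ e <_) (m+n∸m≡n e n)
    (subst (λ m → n + u ∸ e < m ∸ e) (+-comm n e)
      (∸-monoˡ-< (+-monoʳ-< n (≰⇒> e≰u)) (≤-trans (<⇒≤ e<n) (m≤m+n n u))))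

module ClockwiseFrom (n e : ℕ) (e<n : e < n) where

  cwDist-<-above : ∀ {u v} → e ≤ u → u < v → cwDist n e u < cwDist n e v
  cwDist-<-above {u} {v} e≤u u<v
    rewrite cwDist-≤ n e≤u | cwDist-≤ n (≤-trans e≤u (<⇒≤ u<v)) = ∸-monoˡ-< u<v e≤u

  cwDist-<-below : ∀ {u v} → v < e → u < v → cwDist n e u < cwDist n e v
  cwDist-<-below {u} {v} v<e u<v rewrite cwDist-> n (<-trans u<v v<e) | cwDist-> n v<e =
    ∸-monoˡ-< (+-monoʳ-< n u<v) (≤-trans (<⇒≤ e<n) (m≤m+n n u))

  cwDist-<-wrap : ∀ {u v} → e ≤ u → u < n → v < e → cwDist n e u < cwDist n e v
  cwDist-<-wrap {u} {v} e≤u u<n v<e rewrite cwDist-≤ n e≤u | cwDist-> n v<e =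
    ∸-monoˡ-< (<-≤-trans u<n (m≤m+n n v)) e≤u

  cwDist-≢ : ∀ {u v} → u < v → v < n → cwDist n e u ≢ cwDist n e v
  cwDist-≢ {u} {v} u<v v<n eq with e ≤? u | e ≤? v
  ... | yes e≤u | _       = <-irrefl eq (cwDist-<-above e≤u u<v)
  ... | no e≰u  | yes e≤v = <-irrefl (sym eq) (cwDist-<-wrap e≤v v<n (≰⇒> e≰u))
  ... | no _    | no e≰v  = <-irrefl eq (cwDist-<-below (≰⇒> e≰v) u<v)

  cwDist-injective : ∀ {u v} → u < n → v < n → cwDist n e u ≡ cwDist n e v → u ≡ v
  cwDist-injective {u} {v} u<n v<n eq with <-cmp u v
  ... | tri< u<v _ _ = ⊥-elim (cwDist-≢ u<v v<n eq)
  ... | tri≈ _ u≡v _ = u≡v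
  ... | tri> _ _ v<u = ⊥-elim (cwDist-≢ v<u u<n (sym eq))

  cwDist-preserves-ordered : ∀ {u v w} → u < v → v < w → w < n
    → Cyclic (cwDist n e u) (cwDist n e v) (cwDist n e w)
  cwDist-preserves-ordered {u} {v} {w} u<v v<w w<n with e ≤? u | e ≤? v | e ≤? w
  ... | yes e≤u | _       | _       =
    inj₁ (cwDist-<-above e≤u u<v , cwDist-<-above (≤-trans e≤u (<⇒≤ u<v)) v<w)
  ... | no e≰u  | yes e≤v | _       =
    inj₂ (inj₁ (cwDist-<-above e≤v v<w , cwDist-<-wrap (≤-trans e≤v (<⇒≤ v<w)) w<n (≰⇒> e≰u)))
  ... | no e≰u  | no e≰v  | yes e≤w =
    inj₂ (inj₂ (cwDist-<-wrap e≤w w<n (≰⇒> e≰u) , cwDist-<-below (≰⇒> e≰v) u<v))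
  ... | no _    | no e≰v  | no e≰w  =
    inj₁ (cwDist-<-below (≰⇒> e≰v) u<v , cwDist-<-below (≰⇒> e≰w) v<w)

  cwDist-preserves-cyclic : ∀ {u v w} → u < n → v < n → w < n → Cyclic u v w
    → Cyclic (cwDist n e u) (cwDist n e v) (cwDist n e w)
  cwDist-preserves-cyclic _   _   w<n (inj₁ (u<v , v<w))        =
    cwDist-preserves-ordered u<v v<w w<n
  cwDist-preserves-cyclic u<n _   _   (inj₂ (inj₁ (v<w , w<u))) =
    cyclic-rotate (cyclic-rotate (cwDist-preserves-ordered v<w w<u u<n))
  cwDist-preserves-cyclic _   v<n _   (inj₂ (inj₂ (w<u , u<v))) =
    cyclic-rotate (cwDist-preserves-ordered w<u u<v v<n)

  cwDist-reflects-cyclic : ∀ {u v w} → u < n → v < n → w < n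
    → Cyclic (cwDist n e u) (cwDist n e v) (cwDist n e w) → Cyclic u v w
  cwDist-reflects-cyclic {u} {v} {w} u<n v<n w<n c with u ≟ v | v ≟ w | u ≟ w
  ... | yes refl | _        | _        = ⊥-elim (cyclic-irreflˡ c)
  ... | _        | yes refl | _        = ⊥-elim (cyclic-irreflˡ (cyclic-rotate c))
  ... | _        | _        | yes refl = ⊥-elim (cyclic-irreflˡ (cyclic-rotate (cyclic-rotate c)))
  ... | no u≢v   | no v≢w   | no u≢w with cyclic-total u v w u≢v v≢w u≢w
  ...   | inj₁ uvw = uvw
  ...   | inj₂ uwv = ⊥-elim (cyclic-asym c (cwDist-preserves-cyclic u<n w<n v<n uwv))

%-of-<-double : ∀ {m r} .{{_ : NonZero r}} → r ≤ m → m < r + r → m % r ≡ m ∸ r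
%-of-<-double {m} {r} r≤m m<r+r = begin
  m % r       ≡⟨ m≤n⇒[n∸m]%m≡n%m r≤m ⟨
  (m ∸ r) % r ≡⟨ m<n⇒m%n≡m (subst (m ∸ r <_) (m+n∸n≡m r r) (∸-monoˡ-< m<r+r r≤m)) ⟩
  m ∸ r       ∎
  where open ≡-Reasoning

module _ {r : ℕ} .{{_ : NonZero r}} where

  cwDist-+-% : ∀ {e s} → e < r → s < r → cwDist r e ((e + s) % r) ≡ s
  cwDist-+-% {e} {s} e<r s<r with e + s <? r
  ... | yes e+s<r rewrite m<n⇒m%n≡m e+s<r | cwDist-≤ r (m≤m+n e s) = m+n∸m≡n e s
  ... | no e+s≮r
    rewrite %-of-<-double (≮⇒≥ e+s≮r) (+-mono-< e<r s<r)
          | cwDist-> r (subst (e + s ∸ r <_) (m+n∸n≡m e r)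
                         (∸-monoˡ-< (+-monoʳ-< e s<r) (≮⇒≥ e+s≮r)))
          | m+[n∸m]≡n (≮⇒≥ e+s≮r) = m+n∸m≡n e s

  +-cwDist-% : ∀ {e u} → e < r → u < r → (e + cwDist r e u) % r ≡ u
  +-cwDist-% {e} {u} e<r u<r with e ≤? u
  ... | yes e≤u rewrite cwDist-≤ r e≤u | m+[n∸m]≡n e≤u = m<n⇒m%n≡m u<r
  ... | no e≰u rewrite cwDist-> r (≰⇒> e≰u) | m+[n∸m]≡n (≤-trans (<⇒≤ e<r) (m≤m+n r u))
                     | +-comm r u = trans ([m+n]%n≡m%n u r) (m<n⇒m%n≡m u<r)

module _ {n : ℕ} where

  cd-preserves-cyclic : (e : Fin n) {u v w : Fin n}
    → Cyc u v w → Cyclic (cd e u) (cd e v) (cd e w)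
  cd-preserves-cyclic e {u} {v} {w} =
    ClockwiseFrom.cwDist-preserves-cyclic n (toℕ e) (toℕ<n e) (toℕ<n u) (toℕ<n v) (toℕ<n w)

  cd-reflects-cyclic : (e : Fin n) {u v w : Fin n}
    → Cyclic (cd e u) (cd e v) (cd e w) → Cyc u v w
  cd-reflects-cyclic e {u} {v} {w} =
    ClockwiseFrom.cwDist-reflects-cyclic n (toℕ e) (toℕ<n e) (toℕ<n u) (toℕ<n v) (toℕ<n w)

  cd-self : (e : Fin n) → cd e e ≡ 0
  cd-self e = cwDist-self n (toℕ e)

  cd-injective : (e : Fin n) {u v : Fin n} → cd e u ≡ cd e v → u ≡ v
  cd-injective e {u} {v} eq =
    toℕ-injective (ClockwiseFrom.cwDist-injective n (toℕ e) (toℕ<n e) (toℕ<n u) (toℕ<n v) eq)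

  cd-pos : {a b : Fin n} → a ≢ b → 0 < cd a b
  cd-pos {a} a≢b = n≢0⇒n>0 (λ cd≡0 → a≢b (cd-injective a (trans (cd-self a) (sym cd≡0))))

  cyc⇒cd<cd : {e b c : Fin n} → Cyc e b c → 0 < cd e b × cd e b < cd e c
  cyc⇒cd<cd {e} {b} {c} ebc =
    cyclic-0 (subst (λ z → Cyclic z (cd e b) (cd e c)) (cd-self e) (cd-preserves-cyclic e ebc))

  cd<cd⇒cyc : {e b c : Fin n} → 0 < cd e b → cd e b < cd e c → Cyc e b c
  cd<cd⇒cyc {e} {b} {c} 0<b b<c =
    cd-reflects-cyclic e
      (subst (λ z → Cyclic z (cd e b) (cd e c)) (sym (cd-self e)) (inj₁ (0<b , b<c)))

  _∈[_,_⟩ : Fin n → Fin n → Fin n → Set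
  v ∈[ a , b ⟩ = v ≡ a ⊎ Cyc a v b

  _∈⟨_,_] : Fin n → Fin n → Fin n → Set
  v ∈⟨ a , b ] = v ≡ b ⊎ Cyc a v b

module _ {a p} {A : Set a} {P : Pred A p} (P? : Decidable P) where

  count-all : ∀ {m} (h : Fin m → A) → (∀ i → P (h i)) → count P? (tabulate h) ≡ m
  count-all {zero}  h all = refl
  count-all {suc m} h all with P? (h Fin.zero)
  ... | yes _ = cong suc (count-all (h ∘ Fin.suc) (all ∘ Fin.suc))
  ... | no ¬p = ⊥-elim (¬p (all Fin.zero))

  count-all-but-one : ∀ {m} (h : Fin m → A) (i₁ : Fin m) → ¬ P (h i₁)
    → (∀ i → i ≢ i₁ → P (h i)) → suc (count P? (tabulate h)) ≡ m
  count-all-but-one {suc m} h Fin.zero ¬p₁ rest with P? (h Fin.zero)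
  ... | yes p₁ = ⊥-elim (¬p₁ p₁)
  ... | no _   = cong suc (count-all (h ∘ Fin.suc) (λ i → rest (Fin.suc i) (λ ())))
  count-all-but-one {suc m} h (Fin.suc i₁) ¬p₁ rest with P? (h Fin.zero)
  ... | yes _ = cong suc (count-all-but-one (h ∘ Fin.suc) i₁ ¬p₁
                  (λ i i≢i₁ → rest (Fin.suc i) (i≢i₁ ∘ suc-injective)))
  ... | no ¬p = ⊥-elim (¬p (rest Fin.zero (λ ())))

  count-all-but-two : ∀ {m} (h : Fin m → A) (i₁ i₂ : Fin m) → i₁ ≢ i₂
    → ¬ P (h i₁) → ¬ P (h i₂) → (∀ i → i ≢ i₁ → i ≢ i₂ → P (h i))
    → suc (suc (count P? (tabulate h))) ≡ m
  count-all-but-two {suc m} h Fin.zero Fin.zero i₁≢i₂ _ _ _ = ⊥-elim (i₁≢i₂ refl)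
  count-all-but-two {suc m} h Fin.zero (Fin.suc i₂) _ ¬p₁ ¬p₂ rest with P? (h Fin.zero)
  ... | yes p₁ = ⊥-elim (¬p₁ p₁)
  ... | no _   = cong suc (count-all-but-one (h ∘ Fin.suc) i₂ ¬p₂
                   (λ i i≢i₂ → rest (Fin.suc i) (λ ()) (i≢i₂ ∘ suc-injective)))
  count-all-but-two {suc m} h (Fin.suc i₁) Fin.zero _ ¬p₁ ¬p₂ rest with P? (h Fin.zero)
  ... | yes p₂ = ⊥-elim (¬p₂ p₂)
  ... | no _   = cong suc (count-all-but-one (h ∘ Fin.suc) i₁ ¬p₁
                   (λ i i≢i₁ → rest (Fin.suc i) (i≢i₁ ∘ suc-injective) (λ ())))
  count-all-but-two {suc m} h (Fin.suc i₁) (Fin.suc i₂) i₁≢i₂ ¬p₁ ¬p₂ rest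
    with P? (h Fin.zero)
  ... | yes _ = cong suc (count-all-but-two (h ∘ Fin.suc) i₁ i₂ (i₁≢i₂ ∘ cong Fin.suc) ¬p₁ ¬p₂
                  (λ i i≢i₁ i≢i₂ → rest (Fin.suc i) (i≢i₁ ∘ suc-injective)
                                                    (i≢i₂ ∘ suc-injective)))
  ... | no ¬p = ⊥-elim (¬p (rest Fin.zero (λ ()) (λ ())))

module _ {n : ℕ} {T : Diagonals {n}} where

  StartArc : Fin n → Seg {T = T} → Set
  StartArc x s = x ∈[ entryV s , entryV' s ⟩

  EndArc : Fin n → Seg {T = T} → Set
  EndArc y s = y ∈⟨ exitV' s , exitV s ]

-- Tile Q seen from q_j: w t = q_{j+t}, so w (1 + k) = q_{j-2} and w (2 + k) = q_{j-1};
-- dist t is the clockwise distance from q_j to w t.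
module FromVertex {n : ℕ} {T : Diagonals {n}} (Q : Tile T) (j : Fin (size Q)) where
  open Tile Q

  r : ℕ
  r = size Q

  J : ℕ
  J = toℕ j

  qj : Fin n
  qj = q Q J

  w : ℕ → Fin n
  w t = q Q (J + t)

  idx : ℕ → Fin r
  idx t = (J + t) mod r

  dist : ℕ → ℕ
  dist t = cd qj (w t)

  1<r : 1 < r
  1<r = s≤s (s≤s z≤n)

  penultimate<r : 1 + k < r
  penultimate<r = s≤s (s≤s (n≤1+n k))

  last<r : 2 + k < r
  last<r = ≤-refl

  vert-cyclic : ∀ {a b c : Fin r} → Cyclic (toℕ a) (toℕ b) (toℕ c) → Cyc (vert a) (vert b) (vert c)
  vert-cyclic {a} {b} {c} (inj₁ (a<b , b<c))        = clockwise a b c a<b b<c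
  vert-cyclic {a} {b} {c} (inj₂ (inj₁ (b<c , c<a))) =
    cyclic-rotate (cyclic-rotate (clockwise b c a b<c c<a))
  vert-cyclic {a} {b} {c} (inj₂ (inj₂ (c<a , a<b))) = cyclic-rotate (clockwise c a b c<a a<b)

  toℕ-idx : ∀ t → toℕ (idx t) ≡ (J + t) % r
  toℕ-idx t = toℕ-fromℕ< (m%n<n (J + t) r)

  cwDist-idx : ∀ {t} → t < r → cwDist r J (toℕ (idx t)) ≡ t
  cwDist-idx {t} t<r = trans (cong (cwDist r J) (toℕ-idx t)) (cwDist-+-% (toℕ<n j) t<r)

  idx-surjective : ∀ (i : Fin r) → Σ ℕ (λ t → t < r × idx t ≡ i)
  idx-surjective i = cwDist r J (toℕ i) , cwDist-< (toℕ<n j) (toℕ<n i) ,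
    toℕ-injective (trans (toℕ-idx _) (+-cwDist-% (toℕ<n j) (toℕ<n i)))

  idx-0 : idx 0 ≡ j
  idx-0 = toℕ-injective (begin
    toℕ (idx 0)   ≡⟨ toℕ-idx 0 ⟩
    (J + 0) % r   ≡⟨ cong (_% r) (+-identityʳ J) ⟩
    J % r         ≡⟨ m<n⇒m%n≡m (toℕ<n j) ⟩
    J             ∎)
    where open ≡-Reasoning

  w-0 : w 0 ≡ qj
  w-0 = cong (q Q) (+-identityʳ J)

  vert-j : vert j ≡ qj
  vert-j = trans (cong vert (sym idx-0)) w-0

  w-cyclic : ∀ {s t u} → s < t → t < u → u < r → Cyc (w s) (w t) (w u)
  w-cyclic {s} {t} {u} s<t t<u u<r = vert-cyclic (ClockwiseFrom.cwDist-reflects-cyclic r J (toℕ<n j)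
    (toℕ<n (idx s)) (toℕ<n (idx t)) (toℕ<n (idx u)) offsets)
    where
    offsets : Cyclic (cwDist r J (toℕ (idx s))) (cwDist r J (toℕ (idx t)))
                     (cwDist r J (toℕ (idx u)))
    offsets rewrite cwDist-idx (<-trans s<t (<-trans t<u u<r)) | cwDist-idx (<-trans t<u u<r)
                  | cwDist-idx u<r = inj₁ (s<t , t<u)

  dist-0 : dist 0 ≡ 0
  dist-0 = trans (cong (cd qj) w-0) (cd-self qj)

  dist-between : ∀ {t u} → 0 < t → t < u → u < r → 0 < dist t × dist t < dist u
  dist-between {t} {u} 0<t t<u u<r =
    cyc⇒cd<cd (subst (λ v → Cyc v (w t) (w u)) w-0 (w-cyclic 0<t t<u u<r))

  dist-pos : ∀ {t} → 0 < t → t < r → 0 < dist t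
  dist-pos {suc zero}    _ _   = proj₁ (dist-between z<s (s≤s (s≤s z≤n)) (s≤s (s≤s (s≤s z≤n))))
  dist-pos {suc (suc t)} _ t<r = uncurry <-trans (dist-between z<s (s≤s (s≤s z≤n)) t<r)

  dist-mono-< : ∀ {t u} → t < u → u < r → dist t < dist u
  dist-mono-< {zero}  {u} 0<u u<r = subst (_< dist u) (sym dist-0) (dist-pos 0<u u<r)
  dist-mono-< {suc t}     t<u u<r = proj₂ (dist-between z<s t<u u<r)

  dist-mono-≤ : ∀ {t u} → t ≤ u → u < r → dist t ≤ dist u
  dist-mono-≤ t≤u u<r with m≤n⇒m<n∨m≡n t≤u
  ... | inj₁ t<u  = <⇒≤ (dist-mono-< t<u u<r)
  ... | inj₂ refl = ≤-refl

  startArc-dist : ∀ {x} → StartArc x (Q , j) → cd qj x < dist 1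
  startArc-dist (inj₁ refl) = subst (_< dist 1) (sym (cd-self qj)) (dist-pos z<s 1<r)
  startArc-dist (inj₂ c)    = proj₂ (cyc⇒cd<cd c)

  endArc-dist : ∀ {y} → EndArc y (Q , j) → dist (1 + k) < cd qj y × cd qj y ≤ dist (2 + k)
  endArc-dist (inj₁ refl) = dist-mono-< ≤-refl last<r , ≤-refl
  endArc-dist (inj₂ c) =
    map₂ <⇒≤ (cyclic⇒between (dist-mono-< ≤-refl last<r) (cd-preserves-cyclic qj c))

  startArc-through : ∀ {x} → StartArc x (Q , j) → x ∈[ exitV (Q , j) , exitV' (Q , j) ⟩
  startArc-through x∈ = inj₂ (cd-reflects-cyclic qj (inj₂ (inj₁
    ( <-≤-trans (startArc-dist x∈) (dist-mono-≤ (s≤s z≤n) penultimate<r)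
    , dist-mono-< ≤-refl last<r))))

  endArc-through : ∀ {y} → EndArc y (Q , j) → y ∈⟨ entryV' (Q , j) , entryV (Q , j) ]
  endArc-through {y} y∈ = inj₂ (cyclic-rotate qj-w₁-y)
    where
    qj-w₁-y : Cyc qj (w 1) y
    qj-w₁-y = cd<cd⇒cyc (dist-pos z<s 1<r)
      (≤-<-trans (dist-mono-≤ (s≤s z≤n) penultimate<r) (proj₁ (endArc-dist y∈)))

  module Covering {x y : Fin n} (x∈ : StartArc x (Q , j)) (y∈ : EndArc y (Q , j)) where

    x<1 : cd qj x < dist 1
    x<1 = startArc-dist x∈

    penultimate<y : dist (1 + k) < cd qj y
    penultimate<y = proj₁ (endArc-dist y∈)

    y≤last : cd qj y ≤ dist (2 + k)
    y≤last = proj₂ (endArc-dist y∈)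

    x<y : cd qj x < cd qj y
    x<y = <-trans (<-≤-trans x<1 (dist-mono-≤ (s≤s z≤n) penultimate<r)) penultimate<y

    qj≢last : qj ≢ w (2 + k)
    qj≢last eq = <-irrefl (trans (sym (cd-self qj)) (cong (cd qj) eq)) (dist-pos z<s last<r)

    covers-w : ∀ {t} → 0 < t → t < 2 + k → Covers x y (w t)
    covers-w 0<t t<2+k = cd-reflects-cyclic qj (inj₁
      ( <-≤-trans x<1 (dist-mono-≤ 0<t (<-trans t<2+k last<r))
      , ≤-<-trans (dist-mono-≤ (s≤s⁻¹ t<2+k) penultimate<r) penultimate<y))

    ¬covers-qj : ¬ Covers x y qj
    ¬covers-qj c =
      n≮0 (subst (cd qj x <_) (cd-self qj) (proj₁ (cyclic⇒between x<y (cd-preserves-cyclic qj c))))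

    ¬covers-vert-j : ¬ Covers x y (vert j)
    ¬covers-vert-j = ¬covers-qj ∘ subst (Covers x y) vert-j

    ¬covers-last : ¬ Covers x y (w (2 + k))
    ¬covers-last c = <⇒≱ (proj₂ (cyclic⇒between x<y (cd-preserves-cyclic qj c))) y≤last

    covers-others : ∀ i → i ≢ j → i ≢ idx (2 + k) → Covers x y (vert i)
    covers-others i i≢j i≢last with idx-surjective i
    ... | zero , _ , refl = ⊥-elim (i≢j idx-0)
    ... | suc t , t<r , refl with m≤n⇒m<n∨m≡n (s≤s⁻¹ t<r)
    ...   | inj₁ t<2+k = covers-w z<s t<2+k
    ...   | inj₂ refl  = ⊥-elim (i≢last refl)

    coveredCount-≡ : coveredCount Q x y ≡ r ∸ 2
    coveredCount-≡ = cong (_∸ 2)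
      (count-all-but-two (λ i → cyc? x (vert i) y) (λ i → i) j (idx (2 + k))
        (λ j≡last → qj≢last (trans (sym vert-j) (cong vert j≡last)))
        ¬covers-vert-j ¬covers-last covers-others)

    cd-last<cd-qj : cd y (w (2 + k)) < cd y qj
    cd-last<cd-qj with y Fin.≟ w (2 + k)
    ... | yes refl = subst (_< cd y qj) (sym (cd-self y)) (cd-pos (qj≢last ∘ sym))
    ... | no y≢last =
      proj₂ (cyc⇒cd<cd {e = y} {b = w (2 + k)} {c = qj} (cyclic-rotate qj-y-last))
      where
      qj-y-last : Cyc qj y (w (2 + k))
      qj-y-last =
        cd<cd⇒cyc (≤-<-trans z≤n penultimate<y) (≤∧≢⇒< y≤last (y≢last ∘ cd-injective qj))

    cd-qj≤cd-x : cd y qj ≤ cd y x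
    cd-qj≤cd-x with x Fin.≟ qj
    ... | yes refl = ≤-refl
    ... | no x≢qj  =
      <⇒≤ (proj₂ (cyc⇒cd<cd {e = y} {b = qj} {c = x} (cyclic-rotate (cyclic-rotate qj-x-y))))
      where
      qj-x-y : Cyc qj x y
      qj-x-y = cd<cd⇒cyc (cd-pos (x≢qj ∘ sym)) x<y

module _ {n : ℕ} {T : Diagonals {n}} where

  startArc-next : ∀ {x} {s s' : Seg {T = T}} → Next s s' → StartArc x s → StartArc x s'
  startArc-next {x} {Q , j} (_ , entry≡exit , entry'≡exit') x∈ =
    subst₂ (λ a b → x ∈[ a , b ⟩) (sym entry≡exit) (sym entry'≡exit')
      (FromVertex.startArc-through Q j x∈)

  endArc-previous : ∀ {y} {s s' : Seg {T = T}} → Next s s' → EndArc y s' → EndArc y s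
  endArc-previous {y} {s' = Q , j} (_ , entry≡exit , entry'≡exit') y∈ =
    subst₂ (λ a b → y ∈⟨ a , b ]) entry'≡exit' entry≡exit (FromVertex.endArc-through Q j y∈)

  startArc-reach : ∀ {x} {s s' : Seg {T = T}} → Reach s s' → StartArc x s → StartArc x s'
  startArc-reach here x∈ = x∈
  startArc-reach (there {s = s} {s₁} next s₁⇝) x∈ =
    startArc-reach s₁⇝ (startArc-next {s = s} {s₁} next x∈)

  endArc-reach : ∀ {y} {s s' : Seg {T = T}} → Reach s s' → EndArc y s' → EndArc y s
  endArc-reach here y∈ = y∈
  endArc-reach (there {s = s} {s₁} next s₁⇝) y∈ =
    endArc-previous {s = s} {s₁} next (endArc-reach s₁⇝ y∈)

mainTheorem13 : {n : ℕ} → 3 ≤ n → (T : Diagonals {n}) → IsTiling T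
    → (Q : Tile T) → (x y : Fin n) → LongStrandFor Q x y
    → (coveredCount Q x y ≡ size Q ∸ 2)
      × Σ (Fin (size Q)) (λ i →
          ¬ Covers x y (q Q (toℕ i + (2 + Tile.k Q)))
          × ¬ Covers x y (Tile.vert Q i)
          × (∀ (j : Fin (size Q)) → Tile.vert Q j ≢ q Q (toℕ i + (2 + Tile.k Q))
               → Tile.vert Q j ≢ Tile.vert Q i → Covers x y (Tile.vert Q j))
          × cd y (q Q (toℕ i + (2 + Tile.k Q))) < cd y (Tile.vert Q i)
          × cd y (Tile.vert Q i) ≤ cd y x)
mainTheorem13 _ T _ Q x y (j , s₀ , s₁ , _ , s₀-x , s₀⇝Q , Q⇝s₁ , _ , s₁-y) =
  coveredCount-≡ , j , ¬covers-last , ¬covers-vert-j ,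
  (λ i i≢last i≢j → covers-others i (i≢j ∘ cong vert) (i≢last ∘ cong vert)) ,
  subst (λ v → cd y (w (2 + k)) < cd y v) (sym vert-j) cd-last<cd-qj ,
  subst (λ v → cd y v ≤ cd y x) (sym vert-j) cd-qj≤cd-x
  where
  open Tile Q using (k; vert)
  open FromVertex Q j
  open Covering (startArc-reach s₀⇝Q (inj₁ (sym s₀-x))) (endArc-reach Q⇝s₁ (inj₁ (sym s₁-y)))
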